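{- Let $n,a,s$ be integers with $n,a,s \geq 2$, and let $b$ be an integer with $0 \leq b \leq s-1$ such that $n = as + b$. Then the chromatic number of the graph $\mathcal{F}_n^s$ is $\chi(\mathcal{F}_n^s) = \left\lceil \frac{n}{a} \right\rceil$.
   Context: $[n]=\{1,\dots,n\}$. A set $S \subseteq [n]$ is $s$-stable if any two distinct $i,j \in S$ satisfy $s \leq |i-j| \leq n-s$. $\mathcal{F}_n^s$ is the graph with vertex set $[n]$ whose edges are exactly the 2-element subsets of $[n]$ that are not $s$-stable, i.e. $\{i,j\}$ ($i\ne j$) is an edge iff $|i-j|<s$ or $|i-j|>n-s$. $\chi$ denotes the usual (proper vertex coloring) chromatic number of a graph. -}

module Defs where

open import Data.Nat using (ℕ; suc; _+_; _∸_; _<_; _≤_; ∣_-_∣; NonZero)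
open import Data.Nat.DivMod using (_/_)
open import Data.Fin using (Fin; toℕ)
open import Data.Product using (Σ; _×_)
open import Data.Sum using (_⊎_)
open import Relation.Binary.PropositionalEquality using (_≡_)
open import Relation.Nullary using (¬_)

record Graph (n : ℕ) : Set₁ where
  field
    Adj : Fin n → Fin n → Set

open Graph public

-- Vertex i : Fin n represents the element (toℕ i + 1) of [n];
-- differences |i - j| are unaffected by this shift.
-- {i,j} (i ≠ j) is an edge of F_n^s iff |i-j| < s or |i-j| > n - s.
F : (n s : ℕ) → Graph n
F n s = record
  { Adj = λ i j → ¬ (i ≡ j) × (∣ toℕ i - toℕ j ∣ < s ⊎ n ∸ s < ∣ toℕ i - toℕ j ∣) }

ProperColouring : {n : ℕ} → Graph n → (k : ℕ) → (Fin n → Fin k) → Set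
ProperColouring G k c = ∀ i j → Adj G i j → ¬ (c i ≡ c j)

Colourable : {n : ℕ} → Graph n → ℕ → Set
Colourable G k = Σ (Fin _ → Fin k) (ProperColouring G k)

ChromaticNumber : {n : ℕ} → Graph n → ℕ → Set
ChromaticNumber G k = Colourable G k × (∀ m → m < k → ¬ Colourable G m)

⌈_/_⌉ : (m d : ℕ) → .{{NonZero d}} → ℕ
⌈ m / d ⌉ = (m + d ∸ 1) / d

{-# OPTIONS --safe #-}
-- Lower bound: a colour class of F_n^s is a set of positions pairwise at cyclic distance ≥ s.
-- Starting from any of its points, the window of a s consecutive positions contains the whole
-- class (as n < (a + 1) s), and each of its a sub-windows of length s contains at most one
-- point; so every class has at most a points and n ≤ χ a.
-- Upper bound: with k = ⌈n/a⌉ write n = u k + t (k - 1), u + t = a, and colour [0, n) by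
-- the offset within u consecutive blocks of length k followed by t blocks of length k - 1.
-- Two vertices of the same colour are then at least one block length ≥ s apart, in both
-- directions around the cycle (k - 1 ≥ s whenever t > 0 because a s ≤ n < k a).
module Submission where

open import Defs
open import Data.Nat
open import Data.Nat.Properties
open import Data.Nat.DivMod
open import Data.Nat.Tactic.RingSolver using (solve-∀)
open import Data.Fin using (Fin; toℕ; fromℕ<)
open import Data.Fin.Properties using (toℕ-fromℕ<; toℕ-injective; toℕ<n)
open import Data.Product using (_×_; _,_; proj₁; proj₂)
open import Data.Sum using (_⊎_; inj₁; inj₂)
open import Function using (_∘_)
open import Relation.Nullary using (¬_; Dec; yes; no; contradiction)
open import Relation.Unary using (Decidable)
open import Relation.Binary using (tri<; tri≈; tri>)
open import Relation.Binary.PropositionalEquality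
open import Algebra.Properties.CommutativeSemigroup +-commutativeSemigroup
  using () renaming (x∙yz≈y∙xz to m+[n+o]≡n+[m+o]; interchange to +-interchange)

Close : ℕ → ℕ → ℕ → Set
Close n s d = d < s ⊎ n ∸ s < d

StablePair : ℕ → ℕ → ℕ → ℕ → Set
StablePair n s x y = x + s ≤ y × y + s ≤ x + n

module _ {n s x d : ℕ} where

  offset-stable⇒¬close : StablePair n s x (x + d) → ¬ Close n s d
  offset-stable⇒¬close (x+s≤x+d , _) (inj₁ d<s) = <⇒≱ d<s (+-cancelˡ-≤ x s d x+s≤x+d)
  offset-stable⇒¬close (_ , x+d+s≤x+n) (inj₂ n∸s<d) =
    <⇒≱ n∸s<d (m+n≤o⇒m≤o∸n d (+-cancelˡ-≤ x (d + s) n (subst (_≤ x + n) (+-assoc x d s) x+d+s≤x+n)))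

  ¬close⇒offset-stable : ¬ Close n s d → StablePair n s x (x + d)
  ¬close⇒offset-stable ¬close =
    +-monoʳ-≤ x s≤d , subst (_≤ x + n) (sym (+-assoc x d s)) (+-monoʳ-≤ x d+s≤n)
    where
    s≤d : s ≤ d
    s≤d = ≮⇒≥ (¬close ∘ inj₁)
    d≤n∸s : d ≤ n ∸ s
    d≤n∸s = ≮⇒≥ (¬close ∘ inj₂)
    d+s≤n : d + s ≤ n
    d+s≤n = m≤o∸n⇒m+n≤o d (≤-trans s≤d (≤-trans d≤n∸s (m∸n≤m n s))) d≤n∸s

module _ {n s x y : ℕ} (x≤y : x ≤ y) where

  stable⇒¬close : StablePair n s x y → ¬ Close n s ∣ x - y ∣
  stable⇒¬close stable rewrite m≤n⇒∣m-n∣≡n∸m x≤y =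
    offset-stable⇒¬close (subst (StablePair n s x) (sym (m+[n∸m]≡n x≤y)) stable)

  ¬close⇒stable : ¬ Close n s ∣ x - y ∣ → StablePair n s x y
  ¬close⇒stable ¬close rewrite m≤n⇒∣m-n∣≡n∸m x≤y =
    subst (StablePair n s x) (m+[n∸m]≡n x≤y) (¬close⇒offset-stable ¬close)

proper⇒stable : ∀ {n s m} {c : Fin n → Fin m} → ProperColouring (F n s) m c →
                ∀ {i j} → toℕ i < toℕ j → c i ≡ c j → StablePair n s (toℕ i) (toℕ j)
proper⇒stable proper {i} {j} i<j ci≡cj = ¬close⇒stable (<⇒≤ i<j) λ close →
  proper i j ((λ i≡j → <⇒≢ i<j (cong toℕ i≡j)) , close) ci≡cj

colourable-byℕ : ∀ {n s k} (col : ℕ → ℕ) → (∀ {x} → x < n → col x < k) →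
                 (∀ {x y} → x < y → y < n → col x ≡ col y → StablePair n s x y) →
                 Colourable (F n s) k
colourable-byℕ {n} {s} {k} col col<k stable = c , proper
  where
  c : Fin n → Fin k
  c i = fromℕ< (col<k (toℕ<n i))

  c≡⇒col≡ : ∀ {i j} → c i ≡ c j → col (toℕ i) ≡ col (toℕ j)
  c≡⇒col≡ ci≡cj = trans (sym (toℕ-fromℕ< _)) (trans (cong toℕ ci≡cj) (toℕ-fromℕ< _))

  ordered : ∀ {i j} → toℕ i < toℕ j → c i ≡ c j → ¬ Close n s ∣ toℕ i - toℕ j ∣
  ordered {i} {j} i<j ci≡cj = stable⇒¬close (<⇒≤ i<j) (stable i<j (toℕ<n j) (c≡⇒col≡ ci≡cj))

  proper : ProperColouring (F n s) k c
  proper i j (i≢j , close) ci≡cj with <-cmp (toℕ i) (toℕ j)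
  ... | tri< i<j _ _ = ordered i<j ci≡cj close
  ... | tri≈ _ i≡j _ = i≢j (toℕ-injective i≡j)
  ... | tri> _ _ j<i = ordered j<i (sym ci≡cj) (subst (Close n s) (∣-∣-comm (toℕ i) (toℕ j)) close)

m<n*o⇒0<n : ∀ {m n o} → m < n * o → 0 < n
m<n*o⇒0<n {n = suc _} _ = z<s

module _ (d : ℕ) .{{_ : NonZero d}} where

  m+d≡m%d+[1+m/d]*d : ∀ m → m + d ≡ m % d + suc (m / d) * d
  m+d≡m%d+[1+m/d]*d m = begin
    m + d                   ≡⟨ cong (_+ d) (m≡m%n+[m/n]*n m d) ⟩
    m % d + m / d * d + d   ≡⟨ +-assoc (m % d) (m / d * d) d ⟩
    m % d + (m / d * d + d) ≡⟨ cong (m % d +_) (+-comm (m / d * d) d) ⟩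
    m % d + suc (m / d) * d ∎
    where open ≡-Reasoning

  m<q*d⇒m+d≤m%d+q*d : ∀ {m q} → m < q * d → m + d ≤ m % d + q * d
  m<q*d⇒m+d≤m%d+q*d {m} {q} m<qd = begin
    m + d                   ≡⟨ m+d≡m%d+[1+m/d]*d m ⟩
    m % d + suc (m / d) * d ≤⟨ +-monoʳ-≤ (m % d) (*-monoˡ-≤ d (m<n*o⇒m/o<n {n = q} m<qd)) ⟩
    m % d + q * d           ∎
    where open ≤-Reasoning

  %-≡∧<⇒m+d≤n : ∀ {m n} → m % d ≡ n % d → m < n → m + d ≤ n
  %-≡∧<⇒m+d≤n {m} {n} m%d≡n%d m<n = begin
    m + d                   ≡⟨ m+d≡m%d+[1+m/d]*d m ⟩
    m % d + suc (m / d) * d ≤⟨ +-monoʳ-≤ (m % d) (*-monoˡ-≤ d m/d<n/d) ⟩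
    m % d + n / d * d       ≡⟨ n≡m%d+n/d*d ⟨
    n                       ∎
    where
    open ≤-Reasoning
    n≡m%d+n/d*d : n ≡ m % d + n / d * d
    n≡m%d+n/d*d = trans (m≡m%n+[m/n]*n n d) (cong (_+ n / d * d) (sym m%d≡n%d))
    m/d<n/d : m / d < n / d
    m/d<n/d = *-cancelʳ-< d (m / d) (n / d)
      (+-cancelˡ-< (m % d) _ _ (subst₂ _<_ (m≡m%n+[m/n]*n m d) n≡m%d+n/d*d m<n))

module _ (n d : ℕ) .{{_ : NonZero d}} where

  private
    1+[n+d∸1]≡n+d : suc (n + d ∸ 1) ≡ n + d
    1+[n+d∸1]≡n+d = trans (+-comm 1 _) (m∸n+n≡m (≤-trans (>-nonZero⁻¹ d) (m≤n+m d n)))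

  n≤⌈n/d⌉*d : n ≤ ⌈ n / d ⌉ * d
  n≤⌈n/d⌉*d = +-cancelʳ-≤ d n (⌈ n / d ⌉ * d) (begin
    n + d                                   ≡⟨ 1+[n+d∸1]≡n+d ⟨
    suc (n + d ∸ 1)                         ≡⟨ cong suc (m≡m%n+[m/n]*n (n + d ∸ 1) d) ⟩
    suc ((n + d ∸ 1) % d + ⌈ n / d ⌉ * d)   ≤⟨ +-monoˡ-≤ _ (m%n<n (n + d ∸ 1) d) ⟩
    d + ⌈ n / d ⌉ * d                       ≡⟨ +-comm d _ ⟩
    ⌈ n / d ⌉ * d + d                       ∎)
    where open ≤-Reasoning

  ⌈n/d⌉*d<n+d : ⌈ n / d ⌉ * d < n + d
  ⌈n/d⌉*d<n+d = subst (⌈ n / d ⌉ * d <_) 1+[n+d∸1]≡n+d (s≤s (m/n*n≤m (n + d ∸ 1) d))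

  m<⌈n/d⌉⇒m*d<n : ∀ {m} → m < ⌈ n / d ⌉ → m * d < n
  m<⌈n/d⌉⇒m*d<n {m} m<k = +-cancelʳ-< d (m * d) n (begin-strict
    m * d + d      ≡⟨ +-comm (m * d) d ⟩
    suc m * d      ≤⟨ *-monoˡ-≤ d m<k ⟩
    ⌈ n / d ⌉ * d  <⟨ ⌈n/d⌉*d<n+d ⟩
    n + d          ∎)
    where open ≤-Reasoning

module BlockColouring (n s K u t : ℕ) .{{_ : NonZero K}}
                      (s≤1+K : s ≤ suc K) (s≤K : 0 < t → s ≤ K)
                      (n≡ : n ≡ u * suc K + t * K) where

  A : ℕ
  A = u * suc K

  colour : ℕ → ℕ
  colour x with x <? A
  ... | yes _ = x % suc K
  ... | no _ = (x ∸ A) % K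

  colour<1+K : ∀ x → colour x < suc K
  colour<1+K x with x <? A
  ... | yes _ = m%n<n x (suc K)
  ... | no _ = m<n⇒m<1+n (m%n<n (x ∸ A) K)

  colour≤ : ∀ x → colour x ≤ x
  colour≤ x with x <? A
  ... | yes _ = m%n≤m x (suc K)
  ... | no _ = ≤-trans (m%n≤m (x ∸ A) K) (m∸n≤m x A)

  A≤n : A ≤ n
  A≤n = subst (A ≤_) (sym n≡) (m≤m+n A (t * K))

  y∸A<t*K : ∀ {y} → A ≤ y → y < n → y ∸ A < t * K
  y∸A<t*K A≤y y<n = +-cancelˡ-< A _ _ (subst₂ _<_ (sym (m+[n∸m]≡n A≤y)) n≡ y<n)

  s≤K-beyond-A : ∀ {y} → A ≤ y → y < n → s ≤ K
  s≤K-beyond-A A≤y y<n = s≤K (m<n*o⇒0<n {n = t} (y∸A<t*K A≤y y<n))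

  y+s≤colour+n : ∀ {y} → y < n → y + s ≤ colour y + n
  y+s≤colour+n {y} y<n with y <? A
  ... | yes y<A = begin
    y + s              ≤⟨ +-monoʳ-≤ y s≤1+K ⟩
    y + suc K          ≤⟨ m<q*d⇒m+d≤m%d+q*d (suc K) {q = u} y<A ⟩
    y % suc K + A      ≤⟨ +-monoʳ-≤ (y % suc K) A≤n ⟩
    y % suc K + n      ∎
    where open ≤-Reasoning
  ... | no y≮A = begin
    y + s                     ≤⟨ +-monoʳ-≤ y (s≤K-beyond-A A≤y y<n) ⟩
    y + K                     ≡⟨ cong (_+ K) (m+[n∸m]≡n A≤y) ⟨
    A + (y ∸ A) + K           ≡⟨ +-assoc A (y ∸ A) K ⟩
    A + (y ∸ A + K)           ≤⟨ +-monoʳ-≤ A (m<q*d⇒m+d≤m%d+q*d K {q = t} (y∸A<t*K A≤y y<n)) ⟩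
    A + ((y ∸ A) % K + t * K) ≡⟨ m+[n+o]≡n+[m+o] A ((y ∸ A) % K) (t * K) ⟩
    (y ∸ A) % K + (A + t * K) ≡⟨ cong ((y ∸ A) % K +_) n≡ ⟨
    (y ∸ A) % K + n           ∎
    where
    open ≤-Reasoning
    A≤y = ≮⇒≥ y≮A

  x+s≤y : ∀ {x y} → x < y → y < n → colour x ≡ colour y → x + s ≤ y
  x+s≤y {x} {y} x<y y<n eq with x <? A | y <? A
  ... | yes _ | yes _ = ≤-trans (+-monoʳ-≤ x s≤1+K) (%-≡∧<⇒m+d≤n (suc K) eq x<y)
  ... | no x≮A | yes y<A = contradiction (<-trans x<y y<A) x≮A
  ... | yes x<A | no y≮A = begin
    x + s             ≤⟨ +-monoʳ-≤ x s≤1+K ⟩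
    x + suc K         ≤⟨ m<q*d⇒m+d≤m%d+q*d (suc K) {q = u} x<A ⟩
    x % suc K + A     ≡⟨ cong (_+ A) eq ⟩
    (y ∸ A) % K + A   ≤⟨ +-monoˡ-≤ A (m%n≤m (y ∸ A) K) ⟩
    y ∸ A + A         ≡⟨ m∸n+n≡m (≮⇒≥ y≮A) ⟩
    y                 ∎
    where open ≤-Reasoning
  ... | no x≮A | no y≮A = begin
    x + s             ≤⟨ +-monoʳ-≤ x (s≤K-beyond-A A≤y y<n) ⟩
    x + K             ≡⟨ cong (_+ K) (m+[n∸m]≡n A≤x) ⟨
    A + (x ∸ A) + K   ≡⟨ +-assoc A (x ∸ A) K ⟩
    A + (x ∸ A + K)   ≤⟨ +-monoʳ-≤ A (%-≡∧<⇒m+d≤n K eq (∸-monoˡ-< x<y A≤x)) ⟩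
    A + (y ∸ A)       ≡⟨ m+[n∸m]≡n A≤y ⟩
    y                 ∎
    where
    open ≤-Reasoning
    A≤x = ≮⇒≥ x≮A
    A≤y = ≮⇒≥ y≮A

  sameColour⇒stable : ∀ {x y} → x < y → y < n → colour x ≡ colour y → StablePair n s x y
  sameColour⇒stable {x} {y} x<y y<n eq = x+s≤y x<y y<n eq , (begin
    y + s          ≤⟨ y+s≤colour+n y<n ⟩
    colour y + n   ≡⟨ cong (_+ n) eq ⟨
    colour x + n   ≤⟨ +-monoˡ-≤ n (colour≤ x) ⟩
    x + n          ∎)
    where open ≤-Reasoning

  colourable : Colourable (F n s) (suc K)
  colourable = colourable-byℕ colour (λ {x} _ → colour<1+K x) sameColour⇒stable

[u+t]*[1+K]≡u*[1+K]+t*K+t : ∀ u t K → (u + t) * suc K ≡ u * suc K + t * K + t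
[u+t]*[1+K]≡u*[1+K]+t*K+t = solve-∀

colourable-balanced : ∀ {n a s k} .{{_ : NonZero a}} → 2 ≤ s → a * s ≤ n →
                      n ≤ k * a → k * a < n + a → Colourable (F n s) k
colourable-balanced {n} {a} {s} {k} 2≤s as≤n n≤ka = blocks k s≤k n≤ka
  where
  s≤k : s ≤ k
  s≤k = *-cancelʳ-≤ s k a (subst (_≤ k * a) (*-comm a s) (≤-trans as≤n n≤ka))

  blocks : ∀ k → s ≤ k → n ≤ k * a → k * a < n + a → Colourable (F n s) k
  blocks 0 s≤0 _ _ = contradiction (≤-trans 2≤s s≤0) λ ()
  blocks 1 s≤1 _ _ = contradiction (≤-trans 2≤s s≤1) λ { (s≤s ()) }
  blocks (suc K@(suc _)) s≤1+K n≤ka ka<n+a = BlockColouring.colourable n s K u t s≤1+K s≤K n≡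
    where
    t u : ℕ
    t = suc K * a ∸ n
    u = a ∸ t

    t+n≡ka : t + n ≡ suc K * a
    t+n≡ka = m∸n+n≡m n≤ka

    t<a : t < a
    t<a = +-cancelʳ-< n t a (subst₂ _<_ (sym t+n≡ka) (+-comm n a) ka<n+a)

    n≡ : n ≡ u * suc K + t * K
    n≡ = +-cancelʳ-≡ t n (u * suc K + t * K) (begin
      n + t                    ≡⟨ +-comm n t ⟩
      t + n                    ≡⟨ t+n≡ka ⟩
      suc K * a                ≡⟨ *-comm (suc K) a ⟩
      a * suc K                ≡⟨ cong (_* suc K) (m∸n+n≡m (<⇒≤ t<a)) ⟨
      (u + t) * suc K          ≡⟨ [u+t]*[1+K]≡u*[1+K]+t*K+t u t K ⟩
      u * suc K + t * K + t    ∎)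
      where open ≡-Reasoning

    s≤K : 0 < t → s ≤ K
    s≤K 0<t = ≮⇒≥ λ K<s → <⇒≱ n<ka (begin
      suc K * a   ≤⟨ *-monoˡ-≤ a K<s ⟩
      s * a       ≡⟨ *-comm s a ⟩
      a * s       ≤⟨ as≤n ⟩
      n           ∎)
      where
      open ≤-Reasoning
      n<ka : n < suc K * a
      n<ka = subst (n <_) t+n≡ka (+-monoˡ-≤ n 0<t)

sumRange : (ℕ → ℕ) → ℕ → ℕ → ℕ
sumRange f x zero = 0
sumRange f x (suc t) = f x + sumRange f (suc x) t

sumRange-split : ∀ f x t u → sumRange f x (t + u) ≡ sumRange f x t + sumRange f (x + t) u
sumRange-split f x zero u = cong (λ y → sumRange f y u) (sym (+-identityʳ x))
sumRange-split f x (suc t) u = begin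
  f x + sumRange f (suc x) (t + u)                              ≡⟨ cong (f x +_) (sumRange-split f (suc x) t u) ⟩
  f x + (sumRange f (suc x) t + sumRange f (suc x + t) u)       ≡⟨ +-assoc (f x) _ _ ⟨
  f x + sumRange f (suc x) t + sumRange f (suc x + t) u         ≡⟨ cong (λ y → f x + sumRange f (suc x) t + sumRange f y u) (+-suc x t) ⟨
  f x + sumRange f (suc x) t + sumRange f (x + suc t) u         ∎
  where open ≡-Reasoning

sumRange-+ : ∀ {f g h} → (∀ x → f x ≡ g x + h x) →
             ∀ x t → sumRange f x t ≡ sumRange g x t + sumRange h x t
sumRange-+ f≡g+h x zero = refl
sumRange-+ {f} {g} {h} f≡g+h x (suc t) = begin
  f x + sumRange f (suc x) t                                       ≡⟨ cong₂ _+_ (f≡g+h x) (sumRange-+ f≡g+h (suc x) t) ⟩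
  g x + h x + (sumRange g (suc x) t + sumRange h (suc x) t)        ≡⟨ +-interchange (g x) (h x) _ _ ⟩
  g x + sumRange g (suc x) t + (h x + sumRange h (suc x) t)        ∎
  where open ≡-Reasoning

sumRange-cong : ∀ {f g} x t → (∀ j → x ≤ j → j < x + t → f j ≡ g j) → sumRange f x t ≡ sumRange g x t
sumRange-cong x zero f≗g = refl
sumRange-cong x (suc t) f≗g = cong₂ _+_ (f≗g x ≤-refl (m<m+n x z<s))
  (sumRange-cong (suc x) t λ j x<j j<1+x+t → f≗g j (<⇒≤ x<j) (subst (j <_) (sym (+-suc x t)) j<1+x+t))

sumRange-const : ∀ c x t → sumRange (λ _ → c) x t ≡ t * c
sumRange-const c x zero = refl
sumRange-const c x (suc t) = cong (c +_) (sumRange-const c (suc x) t)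

sumRange-zero : ∀ {f} x t → (∀ j → x ≤ j → j < x + t → f j ≡ 0) → sumRange f x t ≡ 0
sumRange-zero x t f≗0 = trans (sumRange-cong x t f≗0) (trans (sumRange-const 0 x t) (*-zeroʳ t))

indicator : {A : Set} → Dec A → ℕ
indicator (yes _) = 1
indicator (no _) = 0

indicator-yes : ∀ {A : Set} (A? : Dec A) → A → indicator A? ≡ 1
indicator-yes (yes _) _ = refl
indicator-yes (no ¬a) a = contradiction a ¬a

indicator-no : ∀ {A : Set} (A? : Dec A) → ¬ A → indicator A? ≡ 0
indicator-no (yes a) ¬a = contradiction a ¬a
indicator-no (no _) _ = refl

indicator-<-suc : ∀ v r → indicator (v <? suc r) ≡ indicator (v <? r) + indicator (v ≟ r)
indicator-<-suc v r with <-cmp v r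
... | tri< v<r v≢r _
  rewrite indicator-yes (v <? suc r) (m<n⇒m<1+n v<r) | indicator-yes (v <? r) v<r
        | indicator-no (v ≟ r) v≢r = refl
... | tri≈ v≮r refl _
  rewrite indicator-yes (v <? suc r) (n<1+n v) | indicator-no (v <? r) v≮r
        | indicator-yes (v ≟ r) refl = refl
... | tri> _ v≢r r<v
  rewrite indicator-no (v <? suc r) (<⇒≱ r<v ∘ s≤s⁻¹) | indicator-no (v <? r) (<⇒≯ r<v)
        | indicator-no (v ≟ r) v≢r = refl

module StableSetBound {P : ℕ → Set} (P? : Decidable P) {n s a : ℕ} .{{_ : NonZero a}} .{{_ : NonZero s}}
                      (stable : ∀ {i j} → P i → P j → i < j → StablePair n s i j)
                      (n<as+s : n < a * s + s) where

  count : ℕ → ℕ → ℕ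
  count = sumRange (indicator ∘ P?)

  count-none : ∀ x t → (∀ j → x ≤ j → j < x + t → ¬ P j) → count x t ≡ 0
  count-none x t none = sumRange-zero x t λ j x≤j j<x+t → indicator-no (P? j) (none j x≤j j<x+t)

  count-window : ∀ x t → t ≤ s → count x t ≤ 1
  count-window x zero _ = z≤n
  count-window x (suc t) 1+t≤s with P? x
  ... | yes Px = ≤-reflexive (cong suc (count-none (suc x) t λ j x<j j<1+x+t Pj →
    <⇒≱ (subst (j <_) (sym (+-suc x t)) j<1+x+t) (≤-trans (+-monoʳ-≤ x 1+t≤s) (proj₁ (stable Px Pj x<j)))))
  ... | no _ = count-window (suc x) t (<⇒≤ 1+t≤s)

  count-blocks : ∀ x q → count x (q * s) ≤ q
  count-blocks x zero = z≤n
  count-blocks x (suc q) = begin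
    count x (s + q * s)                  ≡⟨ sumRange-split _ x s (q * s) ⟩
    count x s + count (x + s) (q * s)    ≤⟨ +-mono-≤ (count-window x s ≤-refl) (count-blocks (x + s) q) ⟩
    suc q                                ∎
    where open ≤-Reasoning

  count-truncate : ∀ x t u → (∀ j → x + u ≤ j → ¬ P j) → count x t ≤ count x u
  count-truncate x t u none with ≤-total t u
  ... | inj₁ t≤u = begin
    count x t                              ≤⟨ m≤m+n (count x t) _ ⟩
    count x t + count (x + t) (u ∸ t)      ≡⟨ sumRange-split _ x t (u ∸ t) ⟨
    count x (t + (u ∸ t))                  ≡⟨ cong (count x) (m+[n∸m]≡n t≤u) ⟩
    count x u                              ∎
    where open ≤-Reasoning
  ... | inj₂ u≤t = ≤-reflexive (begin
    count x t                              ≡⟨ cong (count x) (m+[n∸m]≡n u≤t) ⟨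
    count x (u + (t ∸ u))                  ≡⟨ sumRange-split _ x u (t ∸ u) ⟩
    count x u + count (x + u) (t ∸ u)      ≡⟨ cong (count x u +_) (count-none (x + u) (t ∸ u) λ j x+u≤j _ → none j x+u≤j) ⟩
    count x u + 0                          ≡⟨ +-identityʳ _ ⟩
    count x u                              ∎)
    where open ≡-Reasoning

  count-from-member : ∀ x t → P x → count x t ≤ a
  count-from-member x t Px = begin
    count x t          ≤⟨ count-truncate x t (a * s) beyond ⟩
    count x (a * s)    ≤⟨ count-blocks x a ⟩
    a                  ∎
    where
    open ≤-Reasoning
    instance _ = m*n≢0 a s
    beyond : ∀ j → x + a * s ≤ j → ¬ P j
    beyond j x+as≤j Pj = <⇒≱ (+-cancelʳ-< s j (x + a * s) (begin-strict
      j + s              ≤⟨ proj₂ (stable Px Pj (<-≤-trans (m<m+n x (>-nonZero⁻¹ (a * s))) x+as≤j)) ⟩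
      x + n              <⟨ +-monoʳ-< x n<as+s ⟩
      x + (a * s + s)    ≡⟨ +-assoc x (a * s) s ⟨
      x + a * s + s      ∎)) x+as≤j

  count≤a : ∀ x t → count x t ≤ a
  count≤a x zero = z≤n
  count≤a x (suc t) = from (P? x)
    where
    from : Dec (P x) → count x (suc t) ≤ a
    from (yes Px) = count-from-member x (suc t) Px
    from (no ¬Px) = subst (λ i → i + count (suc x) t ≤ a) (sym (indicator-no (P? x) ¬Px)) (count≤a (suc x) t)

module _ {n m a : ℕ} (col : ℕ → ℕ) (col<m : ∀ {x} → x < n → col x < m)
         (class≤a : ∀ r → r < m → sumRange (λ x → indicator (col x ≟ r)) 0 n ≤ a) where

  private
    #below : ℕ → ℕ
    #below r = sumRange (λ x → indicator (col x <? r)) 0 n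

    #below≤ : ∀ r → r ≤ m → #below r ≤ r * a
    #below≤ zero _ = ≤-reflexive (sumRange-zero 0 n λ j _ _ → indicator-no (col j <? 0) λ ())
    #below≤ (suc r) r<m = begin
      #below (suc r)                                          ≡⟨ sumRange-+ (λ x → indicator-<-suc (col x) r) 0 n ⟩
      #below r + sumRange (λ x → indicator (col x ≟ r)) 0 n   ≤⟨ +-mono-≤ (#below≤ r (<⇒≤ r<m)) (class≤a r r<m) ⟩
      r * a + a                                               ≡⟨ +-comm (r * a) a ⟩
      suc r * a                                               ∎
      where open ≤-Reasoning

  n≤colours*classSize : n ≤ m * a
  n≤colours*classSize = begin
    n                        ≡⟨ *-identityʳ n ⟨
    n * 1                    ≡⟨ sumRange-const 1 0 n ⟨
    sumRange (λ _ → 1) 0 n   ≡⟨ sumRange-cong 0 n (λ j _ j<n → sym (indicator-yes (col j <? m) (col<m j<n))) ⟩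
    #below m                 ≤⟨ #below≤ m ≤-refl ⟩
    m * a                    ∎
    where open ≤-Reasoning

colourable⇒n≤m*a : ∀ {n s a m} .{{_ : NonZero a}} .{{_ : NonZero s}} →
                   n < a * s + s → Colourable (F n s) m → n ≤ m * a
colourable⇒n≤m*a {n} {s} {a} {m} n<as+s (c , proper) = n≤colours*classSize colourℕ colourℕ<m class≤a
  where
  colourℕ : ℕ → ℕ
  colourℕ x with x <? n
  ... | yes x<n = toℕ (c (fromℕ< x<n))
  ... | no _ = m  -- a colour outside Fin m, so positions beyond n lie in no colour class

  colourℕ<m : ∀ {x} → x < n → colourℕ x < m
  colourℕ<m {x} x<n with x <? n
  ... | yes x<n = toℕ<n _
  ... | no x≮n = contradiction x<n x≮n

  sameColour⇒stable : ∀ {r} → r < m → ∀ {i j} → colourℕ i ≡ r → colourℕ j ≡ r → i < j → StablePair n s i j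
  sameColour⇒stable r<m {i} {j} ci≡r cj≡r i<j with i <? n | j <? n
  ... | yes i<n | yes j<n = subst₂ (StablePair n s) (toℕ-fromℕ< i<n) (toℕ-fromℕ< j<n)
    (proper⇒stable proper (subst₂ _<_ (sym (toℕ-fromℕ< i<n)) (sym (toℕ-fromℕ< j<n)) i<j)
                          (toℕ-injective (trans ci≡r (sym cj≡r))))
  ... | no _ | _ = contradiction r<m (<-irrefl (sym ci≡r))
  ... | yes _ | no _ = contradiction r<m (<-irrefl (sym cj≡r))

  class≤a : ∀ r → r < m → sumRange (λ x → indicator (colourℕ x ≟ r)) 0 n ≤ a
  class≤a r r<m = StableSetBound.count≤a (λ x → colourℕ x ≟ r) (sameColour⇒stable r<m) n<as+s 0 n

theorem2p4 : (n a s b : ℕ) → n ≥ 2 → (a≥2 : a ≥ 2) → s ≥ 2 → b < s → n ≡ a * s + b →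
    ChromaticNumber (F n s) (⌈_/_⌉ n a {{>-nonZero (≤-trans (s≤s z≤n) a≥2)}})
theorem2p4 n a s b _ (s≤s (s≤s _)) s≥2@(s≤s (s≤s _)) b<s refl =
  colourable-balanced s≥2 (m≤m+n (a * s) b) (n≤⌈n/d⌉*d n a) (⌈n/d⌉*d<n+d n a) ,
  λ m m<⌈n/a⌉ colourable →
    <⇒≱ (m<⌈n/d⌉⇒m*d<n n a m<⌈n/a⌉) (colourable⇒n≤m*a (+-monoʳ-< (a * s) b<s) colourable)
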